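{- Every induced subgraph of an un2qBMG is an un2qBMG; that is, the class of underlying undirected graphs of 2qBMGs is hereditary (closed under taking induced subgraphs).
   Context: A rooted phylogenetic tree $T$ is a rooted tree with root $\rho$ in which every non-leaf vertex has at least two children; $L=L(T)$ denotes its leaf set. Write $v\preceq_T u$ if $u$ lies on the path from $\rho$ to $v$, and $\mathrm{lca}_T(x,y)$ for the $\preceq_T$-smallest common ancestor of $x,y$. Let $\sigma\colon L\to S$ be a leaf coloring, where $S$ is a set of two colors. For leaves $x,y$ with $\sigma(x)\neq\sigma(y)$, $y$ is a best match of $x$ if $\mathrm{lca}_T(x,y)\preceq_T\mathrm{lca}_T(x,y')$ for all leaves $y'$ with $\sigma(y')=\sigma(y)$. A truncation map $u_T\colon L\times S\to V(T)$ assigns to each leaf $x$ and color $s$ a vertex on the path from $\rho$ to $x$, with $u_T(x,\sigma(x))=x$. A leaf $y$ is a quasi-best match of $x$ if $y$ is a best match of $x$ and $\mathrm{lca}_T(x,y)\preceq_T u_T(x,\sigma(y))$. The quasi-best match graph of $(T,\sigma,u_T)$ is the vertex-colored digraph on $L$ (colored by $\sigma$) with an arc $xy$ iff $y$ is a quasi-best match of $x$. A 2qBMG is a vertex-colored digraph $(\overrightarrow{G},\sigma)$ with two colors that arises in this way for some $(T,\sigma,u_T)$. (Known equivalent characterization: a digraph with a proper 2-coloring of its vertices is a 2qBMG iff (N1) there are no four distinct vertices $u,t,w,v$ such that $u,v$ are non-adjacent and $ut, vw, tw$ are arcs; (N2) whenever $uv,vw,wt$ are arcs, $ut$ is an arc;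 (N3) for any two distinct vertices $u,v$, if $N^+(u)\cap N^+(v)\neq\emptyset$ then $N^+(u)\subseteq N^+(v)$ or $N^+(v)\subseteq N^+(u)$, where $N^+$ denotes out-neighbourhood.) The underlying undirected graph of a digraph has the same vertex set and an edge $uv$ whenever $uv$ or $vu$ is an arc. An un2qBMG is an undirected graph that is the underlying undirected graph of some 2qBMG. -}

module Defs where

open import Data.Nat using (ℕ; zero; suc)
open import Data.Fin using (Fin)
open import Data.Bool using (Bool)
open import Data.Product using (Σ; ∃; _×_; _,_)
open import Data.Sum using (_⊎_)
open import Relation.Nullary using (¬_)
open import Relation.Binary.PropositionalEquality using (_≡_; _≢_)
open import Function.Bundles using (_⇔_)
open import Level using (0ℓ) renaming (suc to lsuc)

iter : ∀ {A : Set} → (A → A) → ℕ → A → A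
iter f zero    a = a
iter f (suc k) a = f (iter f k a)

-- Colours: S is a two-element set, represented by Bool.
Colour : Set
Colour = Bool

-- Rooted phylogenetic trees whose leaf set is (identified with) Fin n.
-- The tree has vertex set Fin m, root ρ, and every non-root vertex v
-- has the unique parent `parent v` (by convention parent ρ ≡ ρ).
-- Rootedness/acyclicity: iterating `parent` from any vertex reaches ρ.
-- `leaf` is a bijection from Fin n onto the leaves (childless vertices).

record PhyloTree (n : ℕ) : Set where
  field
    m       : ℕ
    ρ       : Fin m
    parent  : Fin m → Fin m
    parentρ : parent ρ ≡ ρ
    reachesRoot : ∀ v → ∃ λ k → iter parent k v ≡ ρ
    leaf    : Fin n → Fin m

  IsChild : Fin m → Fin m → Set
  IsChild c u = c ≢ ρ × parent c ≡ u

  IsLeaf : Fin m → Set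
  IsLeaf v = ∀ c → ¬ IsChild c v

  _⪯_ : Fin m → Fin m → Set
  v ⪯ u = ∃ λ k → iter parent k v ≡ u

  IsLca : Fin m → Fin m → Fin m → Set
  IsLca a b w = a ⪯ w × b ⪯ w × (∀ w' → a ⪯ w' → b ⪯ w' → w ⪯ w')

  field
    phylogenetic : ∀ u c → IsChild c u → ∃ λ c' → IsChild c' u × c' ≢ c
    leaf-injective : ∀ x y → leaf x ≡ leaf y → x ≡ y
    leaf-isLeaf    : ∀ x → IsLeaf (leaf x)
    leaf-onto      : ∀ v → IsLeaf v → ∃ λ x → leaf x ≡ v

open PhyloTree public

record TruncationMap {n : ℕ} (T : PhyloTree n) (σ : Fin n → Colour) : Set where
  field
    uT      : Fin n → Colour → Fin (m T)
    onPath  : ∀ x s → _⪯_ T (leaf T x) (uT x s)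
    ownCol  : ∀ x → uT x (σ x) ≡ leaf T x

open TruncationMap public

BestMatch : ∀ {n} (T : PhyloTree n) (σ : Fin n → Colour) → Fin n → Fin n → Set
BestMatch T σ x y =
  σ x ≢ σ y ×
  (∀ y' → σ y' ≡ σ y → ∀ w w' →
     IsLca T (leaf T x) (leaf T y) w → IsLca T (leaf T x) (leaf T y') w' →
     _⪯_ T w w')

QuasiBestMatch : ∀ {n} (T : PhyloTree n) (σ : Fin n → Colour) →
                 TruncationMap T σ → Fin n → Fin n → Set
QuasiBestMatch T σ u x y =
  BestMatch T σ x y ×
  (∀ w → IsLca T (leaf T x) (leaf T y) w → _⪯_ T w (uT u x (σ y)))

Digraph : ℕ → Set₁
Digraph n = Fin n → Fin n → Set

Graph : ℕ → Set₁
Graph n = Fin n → Fin n → Set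

Is2qBMG : ∀ {n} → Digraph n → (Fin n → Colour) → Set
Is2qBMG {n} A σ =
  Σ (PhyloTree n) λ T → Σ (TruncationMap T σ) λ u →
    ∀ x y → A x y ⇔ QuasiBestMatch T σ u x y

IsUnderlying : ∀ {n} → Graph n → Digraph n → Set
IsUnderlying G A = ∀ x y → G x y ⇔ (A x y ⊎ A y x)

IsUn2qBMG : ∀ {n} → Graph n → Set₁
IsUn2qBMG {n} G =
  Σ (Digraph n) λ A → Σ (Fin n → Colour) λ σ → Is2qBMG A σ × IsUnderlying G A

induced : ∀ {n k} → Graph n → (Fin k → Fin n) → Graph k
induced G f a b = G (f a) (f b)

-- Restricting the quasi-best-match graph of (T, σ, u_T) to a set of leaves yields the
-- quasi-best-match graph of the tree T' that T displays on those leaves. T' arises by deleting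
-- the other leaves one at a time and suppressing parents left with a single child; its vertices
-- embed into T preserving ancestry and lcas. The truncation map is pulled back by sending
-- u_T(x, s) to the greatest vertex of T' below it, unless no remaining leaf of colour s is a best
-- match of x in T: best matches of colour s in T' are then not best matches in T, and
-- u_T'(x, s) := x suppresses them. Underlying undirected graphs commute with restriction.
module Submission where

open import Defs
open import Data.Nat using (ℕ; suc)
open import Data.Fin using (Fin)
open import Relation.Binary.PropositionalEquality using (_≡_)

open import Data.Nat using (zero; pred; _+_; _*_; _∸_; _≤_; _<_; _≤?_; _<?_; s≤s)
open import Data.Nat.Properties using (+-suc; m∸n+n≡m; m≤m*n; ≰⇒>; ≮⇒≥; <⇒≤; ≤-refl; ≤-trans; n≤1+n)
open import Data.Fin using (zero; toℕ; fromℕ; fromℕ<; punchIn; punchOut)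
import Data.Fin.Properties as Fin
open import Data.Fin.Properties using (_≟_)
open import Data.Bool.Properties using () renaming (_≟_ to _≟ᶜ_)
open import Data.Product using (Σ; ∃; _×_; _,_; proj₁; proj₂)
open import Data.Sum using (_⊎_; inj₁; inj₂)
open import Data.Empty using (⊥-elim)
open import Function using (_∘_; id; flip)
open import Function.Bundles using (_⇔_; mk⇔; Equivalence)
open import Relation.Nullary using (¬_; Dec; yes; no; ¬?)
open import Relation.Nullary.Decidable using (_×-dec_; _→-dec_)
open import Relation.Unary using (Decidable)
open import Relation.Binary.PropositionalEquality
  using (_≢_; _≗_; refl; sym; trans; cong; subst; subst₂; module ≡-Reasoning)

module _ {A : Set} (f : A → A) where

  iter-+ : ∀ j k a → iter f (j + k) a ≡ iter f j (iter f k a)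
  iter-+ zero    k a = refl
  iter-+ (suc j) k a = cong f (iter-+ j k a)

  iter-suc : ∀ k a → iter f (suc k) a ≡ iter f k (f a)
  iter-suc zero    a = refl
  iter-suc (suc k) a = cong f (iter-suc k a)

  iter-fixed : ∀ {a} → f a ≡ a → ∀ k → iter f k a ≡ a
  iter-fixed fa zero    = refl
  iter-fixed fa (suc k) = trans (cong f (iter-fixed fa k)) fa

  iter-*-periodic : ∀ {a} p → iter f p a ≡ a → ∀ t → iter f (t * p) a ≡ a
  iter-*-periodic p cyc zero    = refl
  iter-*-periodic {a} p cyc (suc t) = begin
    iter f (p + t * p) a     ≡⟨ iter-+ p (t * p) a ⟩
    iter f p (iter f (t * p) a) ≡⟨ cong (iter f p) (iter-*-periodic p cyc t) ⟩
    iter f p a               ≡⟨ cyc ⟩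
    a                        ∎
    where open ≡-Reasoning

least : ∀ {P : ℕ → Set} → Decidable P → ∀ {n} → P n → ∃ λ i → P i × (∀ {j} → j < i → ¬ P j)
least P? {zero} p = 0 , p , λ ()
least P? {suc n} p with P? 0
... | yes p0 = 0 , p0 , λ ()
... | no ¬p0 with least (P? ∘ suc) p
...   | i , pi , below = suc i , pi , λ { {zero} _ → ¬p0 ; {suc j} (s≤s j<i) → below j<i }

module Ancestry {n : ℕ} (T : PhyloTree n) where

  _≼_ : Fin (m T) → Fin (m T) → Set
  _≼_ = _⪯_ T

  ≼-refl : ∀ {v} → v ≼ v
  ≼-refl = 0 , refl

  ≼-trans : ∀ {u v w} → u ≼ v → v ≼ w → u ≼ w
  ≼-trans {u} (i , p) (j , q) = j + i , trans (iter-+ (parent T) j i u) (trans (cong (iter (parent T) j) p) q)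

  iter-root : ∀ k → iter (parent T) k (ρ T) ≡ ρ T
  iter-root = iter-fixed (parent T) (parentρ T)

  iter-beyond-root : ∀ {v K} → iter (parent T) K v ≡ ρ T → ∀ {j} → K ≤ j → iter (parent T) j v ≡ ρ T
  iter-beyond-root {v} {K} p {j} K≤j = begin
    iter (parent T) j v                           ≡⟨ cong (λ i → iter (parent T) i v) (sym (m∸n+n≡m K≤j)) ⟩
    iter (parent T) ((j ∸ K) + K) v               ≡⟨ iter-+ (parent T) (j ∸ K) K v ⟩
    iter (parent T) (j ∸ K) (iter (parent T) K v) ≡⟨ cong (iter (parent T) (j ∸ K)) p ⟩
    iter (parent T) (j ∸ K) (ρ T)                 ≡⟨ iter-root (j ∸ K) ⟩
    ρ T                                           ∎
    where open ≡-Reasoning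

  periodic⇒root : ∀ {v} k → iter (parent T) (suc k) v ≡ v → v ≡ ρ T
  periodic⇒root {v} k cyc with reachesRoot T v
  ... | K , p = trans (sym (iter-*-periodic (parent T) (suc k) cyc K)) (iter-beyond-root p (m≤m*n K (suc k)))

  fixed⇒root : ∀ {v} → parent T v ≡ v → v ≡ ρ T
  fixed⇒root = periodic⇒root 0

  ≼-antisym : ∀ {u v} → u ≼ v → v ≼ u → u ≡ v
  ≼-antisym (zero , p) _ = p
  ≼-antisym {u} {v} (suc i , p) (j , q) = begin
    u                          ≡⟨ u≡ρ ⟩
    ρ T                        ≡⟨ sym (iter-root (suc i)) ⟩
    iter (parent T) (suc i) (ρ T) ≡⟨ cong (iter (parent T) (suc i)) (sym u≡ρ) ⟩
    iter (parent T) (suc i) u  ≡⟨ p ⟩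
    v                          ∎
    where
    open ≡-Reasoning
    cycle : iter (parent T) (suc (j + i)) u ≡ u
    cycle = trans (cong (λ k → iter (parent T) k u) (sym (+-suc j i))) (proj₂ (≼-trans (suc i , p) (j , q)))
    u≡ρ : u ≡ ρ T
    u≡ρ = periodic⇒root (j + i) cycle

  _≼?_ : ∀ v u → Dec (v ≼ u)
  v ≼? u with reachesRoot T v
  ... | K , p with Fin.any? {n = suc K} (λ i → iter (parent T) (toℕ i) v ≟ u)
  ...   | yes (i , q) = yes (toℕ i , q)
  ...   | no ¬q = no λ (j , q) → ¬q (bounded j q)
    where
    bounded : ∀ j → iter (parent T) j v ≡ u → ∃ λ (i : Fin (suc K)) → iter (parent T) (toℕ i) v ≡ u
    bounded j q with j ≤? K
    ... | yes j≤K = fromℕ< {m = j} (s≤s j≤K) ,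
                    trans (cong (λ i → iter (parent T) i v) (Fin.toℕ-fromℕ< {m = j} (s≤s j≤K))) q
    ... | no j≰K = fromℕ K , (begin
      iter (parent T) (toℕ (fromℕ K)) v ≡⟨ cong (λ i → iter (parent T) i v) (Fin.toℕ-fromℕ K) ⟩
      iter (parent T) K v               ≡⟨ p ⟩
      ρ T                               ≡⟨ sym (iter-beyond-root p (<⇒≤ (≰⇒> j≰K))) ⟩
      iter (parent T) j v               ≡⟨ q ⟩
      u                                 ∎)
      where open ≡-Reasoning

  lca : ∀ x y → ∃ (IsLca T x y)
  lca x y with reachesRoot T x
  ... | K , p with least (λ i → y ≼? iter (parent T) i x) {K} (subst (y ≼_) (sym p) (reachesRoot T y))
  ...   | i , y≼w , below = iter (parent T) i x , (i , refl) , y≼w , minimal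
    where
    minimal : ∀ w' → x ≼ w' → y ≼ w' → iter (parent T) i x ≼ w'
    minimal w' (j , q) y≼w' with j <? i
    ... | yes j<i = ⊥-elim (below j<i (subst (y ≼_) (sym q) y≼w'))
    ... | no j≮i = j ∸ i , trans (sym (iter-+ (parent T) (j ∸ i) i x))
                                  (trans (cong (λ k → iter (parent T) k x) (m∸n+n≡m (≮⇒≥ j≮i))) q)

  root-parent : ∀ {c u} → c ≡ ρ T → parent T c ≡ u → c ≡ u
  root-parent refl pc≡u = trans (sym (parentρ T)) pc≡u

  ≼-isLeaf : ∀ {ℓ v} → IsLeaf T ℓ → v ≼ ℓ → v ≡ ℓ
  ≼-isLeaf {ℓ} {v} isLeaf (k , p) = go k p
    where
    go : ∀ k → iter (parent T) k v ≡ ℓ → v ≡ ℓ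
    go zero    p = p
    go (suc k) p with iter (parent T) k v ≟ ρ T
    ... | yes atRoot = go k (root-parent atRoot p)
    ... | no notRoot = ⊥-elim (isLeaf (iter (parent T) k v) (notRoot , p))

  ≼-child : ∀ {v u} → v ≼ u → v ≢ u → ∃ λ c → IsChild T c u × v ≼ c
  ≼-child {v} {u} (k , p) v≢u = go k p
    where
    go : ∀ k → iter (parent T) k v ≡ u → ∃ λ c → IsChild T c u × v ≼ c
    go zero    p = ⊥-elim (v≢u p)
    go (suc k) p with iter (parent T) k v ≟ u
    ... | yes q = go k q
    ... | no c≢u = iter (parent T) k v , (c≢u ∘ flip root-parent p , p) , (k , refl)

isLca? : ∀ {n} (T : PhyloTree n) x y w → Dec (IsLca T x y w)
isLca? T x y w = x ≼? w ×-dec y ≼? w ×-dec Fin.all? λ w' → x ≼? w' →-dec y ≼? w' →-dec w ≼? w'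
  where open Ancestry T

bestMatch? : ∀ {n} (T : PhyloTree n) σ x y → Dec (BestMatch T σ x y)
bestMatch? T σ x y =
  ¬? (σ x ≟ᶜ σ y) ×-dec Fin.all? λ y' → σ y' ≟ᶜ σ y →-dec Fin.all? λ w → Fin.all? λ w' →
    isLca? T _ _ w →-dec isLca? T _ _ w' →-dec w ≼? w'
  where open Ancestry T

-- T' is the tree displayed by T on the leaves g; floor pulls vertices of T back to T'.
record Restriction {N n : ℕ} (T : PhyloTree N) (T' : PhyloTree n) (g : Fin n → Fin N) : Set where
  open Ancestry T using (_≼_)
  open Ancestry T' using () renaming (_≼_ to _≼'_)
  field
    embed          : Fin (m T') → Fin (m T)
    embed-mono     : ∀ {v u} → v ≼' u → embed v ≼ embed u
    embed-reflects : ∀ {v u} → embed v ≼ embed u → v ≼' u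
    embed-leaf     : ∀ a → embed (leaf T' a) ≡ leaf T (g a)
    lca-image      : ∀ {a b w} → IsLca T (leaf T (g a)) (leaf T (g b)) w → ∃ λ w' → embed w' ≡ w
    floor          : ∀ {a t} → leaf T (g a) ≼ t → Fin (m T')
    leaf-≼-floor   : ∀ {a t} (a≼t : leaf T (g a) ≼ t) → leaf T' a ≼' floor a≼t
    embed-floor-≼  : ∀ {a t} (a≼t : leaf T (g a) ≼ t) → embed (floor a≼t) ≼ t
    floor-greatest : ∀ {a t w} (a≼t : leaf T (g a) ≼ t) → leaf T' a ≼' w → embed w ≼ t → w ≼' floor a≼t

module RestrictionProperties {N n : ℕ} {T : PhyloTree N} {T' : PhyloTree n} {g : Fin n → Fin N}
                             (R : Restriction T T' g) where
  open Restriction R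
  open Ancestry T using (_≼_; ≼-trans; lca)
  open Ancestry T' using () renaming (_≼_ to _≼'_)

  embed-leaf-≼ : ∀ {a w} → leaf T' a ≼' w → leaf T (g a) ≼ embed w
  embed-leaf-≼ {a} p = subst (_≼ _) (embed-leaf a) (embed-mono p)

  reflect-leaf-≼ : ∀ {a w} → leaf T (g a) ≼ embed w → leaf T' a ≼' w
  reflect-leaf-≼ {a} p = embed-reflects (subst (_≼ _) (sym (embed-leaf a)) p)

  embed-lca : ∀ {a b w} → IsLca T' (leaf T' a) (leaf T' b) w → IsLca T (leaf T (g a)) (leaf T (g b)) (embed w)
  embed-lca {a} {b} {w} (a≼w , b≼w , least') with lca (leaf T (g a)) (leaf T (g b))
  ... | W , isLca@(a≼W , b≼W , leastW) with lca-image isLca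
  ...   | W' , refl = embed-leaf-≼ a≼w , embed-leaf-≼ b≼w ,
                      λ w₀ a≼w₀ b≼w₀ → 
                        ≼-trans (embed-mono (least' W' (reflect-leaf-≼ a≼W) (reflect-leaf-≼ b≼W))) (leastW w₀ a≼w₀ b≼w₀)

  lca-preimage : ∀ {a b w} → IsLca T (leaf T (g a)) (leaf T (g b)) w →
                 ∃ λ w' → embed w' ≡ w × IsLca T' (leaf T' a) (leaf T' b) w'
  lca-preimage isLca@(a≼w , b≼w , leastw) with lca-image isLca
  ... | w' , refl = w' , refl , reflect-leaf-≼ a≼w , reflect-leaf-≼ b≼w ,
                    λ w'' a≼w'' b≼w'' → embed-reflects (leastw _ (embed-leaf-≼ a≼w'') (embed-leaf-≼ b≼w''))

Restriction-∘ : ∀ {N n k} {T : PhyloTree N} {T' : PhyloTree n} {T'' : PhyloTree k}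
                {g : Fin n → Fin N} {h : Fin k → Fin n} →
                Restriction T T' g → Restriction T' T'' h → Restriction T T'' (g ∘ h)
Restriction-∘ {T = T} {T'} {T''} {g} {h} R₁ R₂ = record
  { embed          = R₁.embed ∘ R₂.embed
  ; embed-mono     = R₁.embed-mono ∘ R₂.embed-mono
  ; embed-reflects = R₂.embed-reflects ∘ R₁.embed-reflects
  ; embed-leaf     = λ a → trans (cong R₁.embed (R₂.embed-leaf a)) (R₁.embed-leaf (h a))
  ; lca-image      = lca-image
  ; floor          = λ a≼t → R₂.floor (R₁.leaf-≼-floor a≼t)
  ; leaf-≼-floor   = λ a≼t → R₂.leaf-≼-floor (R₁.leaf-≼-floor a≼t)
  ; embed-floor-≼  = λ a≼t → ≼-trans (R₁.embed-mono (R₂.embed-floor-≼ _)) (R₁.embed-floor-≼ a≼t)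
  ; floor-greatest = λ a≼t a≼w w≼t → R₂.floor-greatest _ a≼w (R₁.floor-greatest a≼t (embed-leaf-≼ a≼w) w≼t)
  }
  where
  module R₁ = Restriction R₁
  module R₂ = Restriction R₂
  open RestrictionProperties R₂ using (embed-leaf-≼)
  open Ancestry T using (_≼_; ≼-trans)

  lca-image : ∀ {a b w} → IsLca T (leaf T (g (h a))) (leaf T (g (h b))) w →
              ∃ λ w'' → R₁.embed (R₂.embed w'') ≡ w
  lca-image isLca with RestrictionProperties.lca-preimage R₁ isLca
  ... | w' , refl , isLca' with R₂.lca-image isLca'
  ...   | w'' , refl = w'' , refl

Restriction-resp-≗ : ∀ {N n} {T : PhyloTree N} {T' : PhyloTree n} {g g' : Fin n → Fin N} →
                     g ≗ g' → Restriction T T' g → Restriction T T' g'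
Restriction-resp-≗ {T = T} {g = g} {g'} g≗g' R = record
  { embed          = embed
  ; embed-mono     = embed-mono
  ; embed-reflects = embed-reflects
  ; embed-leaf     = λ a → trans (embed-leaf a) (cong (leaf T) (g≗g' a))
  ; lca-image      = λ {a} {b} {w} →
                       lca-image ∘ subst₂ (λ x y → IsLca T (leaf T x) (leaf T y) w) (sym (g≗g' a)) (sym (g≗g' b))
  ; floor          = floor ∘ resp
  ; leaf-≼-floor   = leaf-≼-floor ∘ resp
  ; embed-floor-≼  = embed-floor-≼ ∘ resp
  ; floor-greatest = floor-greatest ∘ resp
  }
  where
  open Restriction R
  resp : ∀ {a t} → _⪯_ T (leaf T (g' a)) t → _⪯_ T (leaf T (g a)) t
  resp {a} {t} = subst (λ x → _⪯_ T (leaf T x) t) (sym (g≗g' a))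

relabel : ∀ {N n} (T : PhyloTree N) (f : Fin n → Fin N) →
          (∀ a b → f a ≡ f b → a ≡ b) → (∀ x → ∃ λ a → f a ≡ x) → PhyloTree n
relabel T f f-injective f-surjective = record
  { m = m T ; ρ = ρ T ; parent = parent T ; parentρ = parentρ T ; reachesRoot = reachesRoot T
  ; leaf           = leaf T ∘ f
  ; phylogenetic   = phylogenetic T
  ; leaf-injective = λ a b → f-injective a b ∘ leaf-injective T (f a) (f b)
  ; leaf-isLeaf    = leaf-isLeaf T ∘ f
  ; leaf-onto      = λ v isLeaf → let (x , fx) = leaf-onto T v isLeaf ; (a , fa) = f-surjective x
                                  in a , trans (cong (leaf T) fa) fx
  }

relabel-restriction : ∀ {N n} (T : PhyloTree N) (f : Fin n → Fin N) f-injective f-surjective →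
                      Restriction T (relabel T f f-injective f-surjective) f
relabel-restriction T f _ _ = record
  { embed = id ; embed-mono = id ; embed-reflects = id ; embed-leaf = λ _ → refl
  ; lca-image = λ {_} {_} {w} _ → w , refl
  ; floor = λ {_} {t} _ → t ; leaf-≼-floor = id ; embed-floor-≼ = λ _ → ≼-refl ; floor-greatest = λ _ _ → id
  }
  where open Ancestry T

module RestrictedQuasiBestMatches {N n : ℕ} {T : PhyloTree N} {T' : PhyloTree n} {g : Fin n → Fin N}
                                  (R : Restriction T T' g) (σ : Fin N → Colour) (U : TruncationMap T σ) where
  open Restriction R
  open RestrictionProperties R
  open Ancestry T using (_≼_; ≼-trans; lca)
  open Ancestry T' using () renaming (_≼_ to _≼'_; ≼-refl to ≼'-refl; ≼-antisym to ≼'-antisym;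
                                      ≼-isLeaf to ≼'-isLeaf; lca to lca')

  σ' : Fin n → Colour
  σ' = σ ∘ g

  HasBestMatch : Fin n → Colour → Set
  HasBestMatch a s = ∃ λ b → σ' b ≡ s × BestMatch T σ (g a) (g b)

  hasBestMatch? : ∀ a s → Dec (HasBestMatch a s)
  hasBestMatch? a s = Fin.any? λ b → σ' b ≟ᶜ s ×-dec bestMatch? T σ (g a) (g b)

  -- Without a leaf of colour s that is a best match of g a already in T, every best match of
  -- colour s in T' is spurious, and truncating at the leaf a itself removes them.
  truncate : ∀ a s → Dec (s ≡ σ' a) → Dec (HasBestMatch a s) → Fin (m T')
  truncate a s (yes _) _       = leaf T' a
  truncate a s (no _)  (no _)  = leaf T' a
  truncate a s (no _)  (yes _) = floor (onPath U (g a) s)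

  U' : TruncationMap T' σ'
  U' = record
    { uT     = λ a s → truncate a s (s ≟ᶜ σ' a) (hasBestMatch? a s)
    ; onPath = onPath'
    ; ownCol = ownCol'
    }
    where
    onPath' : ∀ a s → leaf T' a ≼' truncate a s (s ≟ᶜ σ' a) (hasBestMatch? a s)
    onPath' a s with s ≟ᶜ σ' a | hasBestMatch? a s
    ... | yes _ | _     = ≼'-refl
    ... | no _  | no _  = ≼'-refl
    ... | no _  | yes _ = leaf-≼-floor (onPath U (g a) s)

    ownCol' : ∀ a → truncate a (σ' a) (σ' a ≟ᶜ σ' a) (hasBestMatch? a (σ' a)) ≡ leaf T' a
    ownCol' a with σ' a ≟ᶜ σ' a
    ... | yes _ = refl
    ... | no σa≢σa = ⊥-elim (σa≢σa refl)

  bestMatch-restrict : ∀ {a b} → BestMatch T σ (g a) (g b) → BestMatch T' σ' a b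
  bestMatch-restrict (σ≢ , closest) = σ≢ , λ b' σb'≡σb w w' isLca isLca' →
    embed-reflects (closest (g b') σb'≡σb (embed w) (embed w') (embed-lca isLca) (embed-lca isLca'))

  bestMatch-extend : ∀ {a b b₀} → BestMatch T' σ' a b → σ' b₀ ≡ σ' b → BestMatch T σ (g a) (g b₀) →
                     BestMatch T σ (g a) (g b)
  bestMatch-extend {a} {b} {b₀} (σ≢ , closest') σb₀≡σb (_ , closest₀) = σ≢ , closest
    where
    closest : ∀ y' → σ y' ≡ σ (g b) → ∀ w w' → IsLca T (leaf T (g a)) (leaf T (g b)) w →
              IsLca T (leaf T (g a)) (leaf T y') w' → w ≼ w'
    closest y' σy' w w' isLca isLca' with lca (leaf T (g a)) (leaf T (g b₀))
    ... | W₀ , isLca₀ with lca-preimage isLca | lca-preimage isLca₀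
    ...   | v , refl , isLcaᵥ | V₀ , refl , isLca₀' =
      ≼-trans (embed-mono (closest' b₀ σb₀≡σb v V₀ isLcaᵥ isLca₀'))
              (closest₀ y' (trans σy' (sym σb₀≡σb)) W₀ w' isLca₀ isLca')

  quasiBestMatch-restrict : ∀ a b → QuasiBestMatch T σ U (g a) (g b) → QuasiBestMatch T' σ' U' a b
  quasiBestMatch-restrict a b (bestMatch@(σ≢ , _) , truncated) = bestMatch-restrict bestMatch , truncated'
    where
    truncated' : ∀ w → IsLca T' (leaf T' a) (leaf T' b) w → w ≼' uT U' a (σ' b)
    truncated' w isLca with σ' b ≟ᶜ σ' a | hasBestMatch? a (σ' b)
    ... | yes σb≡σa | _ = ⊥-elim (σ≢ (sym σb≡σa))
    ... | no _ | no none = ⊥-elim (none (b , refl , bestMatch))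
    ... | no _ | yes _ = floor-greatest (onPath U (g a) (σ' b)) (proj₁ isLca) (truncated (embed w) (embed-lca isLca))

  quasiBestMatch-extend : ∀ a b → QuasiBestMatch T' σ' U' a b → QuasiBestMatch T σ U (g a) (g b)
  quasiBestMatch-extend a b (bestMatch'@(σ≢ , _) , truncated') with σ' b ≟ᶜ σ' a | hasBestMatch? a (σ' b)
  ... | yes σb≡σa | _ = ⊥-elim (σ≢ (sym σb≡σa))
  ... | no _ | no _ with lca' (leaf T' a) (leaf T' b)
  ...   | w , isLca@(a≼w , b≼w , _) = ⊥-elim (σ≢ (cong σ' (sym b≡a)))
    where
    w≡a : w ≡ leaf T' a
    w≡a = ≼'-antisym (truncated' w isLca) a≼w
    b≡a : b ≡ a
    b≡a = leaf-injective T' b a (≼'-isLeaf (leaf-isLeaf T' a) (subst (leaf T' b ≼'_) w≡a b≼w))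
  quasiBestMatch-extend a b (bestMatch' , truncated') | no _ | yes (b₀ , σb₀≡σb , bestMatch₀) =
    bestMatch-extend bestMatch' σb₀≡σb bestMatch₀ , truncated
    where
    truncated : ∀ w → IsLca T (leaf T (g a)) (leaf T (g b)) w → w ≼ uT U (g a) (σ (g b))
    truncated w isLca with lca-preimage isLca
    ... | w' , refl , isLca' = ≼-trans (embed-mono (truncated' w' isLca')) (embed-floor-≼ (onPath U (g a) (σ' b)))

  restriction-2qBMG : (A : Digraph N) → (∀ x y → A x y ⇔ QuasiBestMatch T σ U x y) →
                      Is2qBMG (λ a b → A (g a) (g b)) σ'
  restriction-2qBMG A qbm = T' , U' , λ a b →
    mk⇔ (quasiBestMatch-restrict a b ∘ Equivalence.to (qbm (g a) (g b)))
        (Equivalence.from (qbm (g a) (g b)) ∘ quasiBestMatch-extend a b)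

punchIn′ : ∀ {M} → Fin M → Fin (pred M) → Fin M
punchIn′ {suc M} = punchIn

punchOut′ : ∀ {M} {i j : Fin M} → i ≢ j → Fin (pred M)
punchOut′ {suc M} = punchOut

punchIn′-punchOut′ : ∀ {M} {i j : Fin M} (i≢j : i ≢ j) → punchIn′ i (punchOut′ i≢j) ≡ j
punchIn′-punchOut′ {suc M} = Fin.punchIn-punchOut

punchIn′ᵢ≢i : ∀ {M} (i : Fin M) j → punchIn′ i j ≢ i
punchIn′ᵢ≢i {suc M} = Fin.punchInᵢ≢i

punchIn′-injective : ∀ {M} (i : Fin M) j k → punchIn′ i j ≡ punchIn′ i k → j ≡ k
punchIn′-injective {suc M} = Fin.punchIn-injective

record Enumeration {M : ℕ} (Kept : Fin M → Set) : Set where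
  field
    size              : ℕ
    element           : Fin size → Fin M
    element-kept      : ∀ i → Kept (element i)
    element-injective : ∀ i j → element i ≡ element j → i ≡ j
    index             : ∀ {w} → Kept w → Fin size
    element-index     : ∀ {w} (kept : Kept w) → element (index kept) ≡ w

enumerate-≢ : ∀ {M} (X : Fin M) → Enumeration (_≢ X)
enumerate-≢ X = record
  { size              = _
  ; element           = punchIn′ X
  ; element-kept      = punchIn′ᵢ≢i X
  ; element-injective = punchIn′-injective X
  ; index             = λ w≢X → punchOut′ (w≢X ∘ sym)
  ; element-index     = λ w≢X → punchIn′-punchOut′ (w≢X ∘ sym)
  }

Enumeration-remove : ∀ {M} {Kept : Fin M → Set} {X} → Enumeration Kept → Kept X →
                     Enumeration (λ w → Kept w × w ≢ X)
Enumeration-remove {Kept = Kept} {X} E keptX = record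
  { size              = _
  ; element           = element ∘ punchIn′ I
  ; element-kept      = λ i → element-kept _ , element≢X i
  ; element-injective = λ i j → punchIn′-injective I i j ∘ element-injective _ _
  ; index             = λ (kept , w≢X) → punchOut′ (I≢ kept w≢X)
  ; element-index     = λ (kept , w≢X) →
                          trans (cong element (punchIn′-punchOut′ (I≢ kept w≢X))) (element-index kept)
  }
  where
  open Enumeration E
  I = index keptX
  element≢X : ∀ i → element (punchIn′ I i) ≢ X
  element≢X i eq = punchIn′ᵢ≢i I i (element-injective _ _ (trans eq (sym (element-index keptX))))
  I≢ : ∀ {w} (kept : Kept w) → w ≢ X → I ≢ index kept
  I≢ kept w≢X I≡ = w≢X (trans (sym (element-index kept)) (trans (cong element (sym I≡)) (element-index keptX)))

-- T' has the Kept vertices of T, each attached to `up`, its nearest Kept proper ancestor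
-- (up-shortcut), with root `top`.
record Pruning {N n : ℕ} (T : PhyloTree N) (g : Fin n → Fin N) : Set₁ where
  open Ancestry T using (_≼_)
  field
    Kept         : Fin (m T) → Set
    enumeration  : Enumeration Kept
    up           : Fin (m T) → Fin (m T)
    top          : Fin (m T)
    up-kept      : ∀ {w} → Kept w → Kept (up w)
    top-kept     : Kept top
    up-top       : up top ≡ top
    ≼-up         : ∀ {w} → Kept w → w ≼ up w
    up-shortcut  : ∀ k {w u} → Kept w → Kept u → iter (parent T) (suc k) w ≡ u →
                   ∃ λ j → j ≤ k × iter (parent T) j (up w) ≡ u
    ≼-top        : ∀ {w} → Kept w → w ≼ top
    up-branching : ∀ {w} → Kept w → w ≢ top →
                   ∃ λ w' → Kept w' × w' ≢ top × up w' ≡ up w × w' ≢ w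
    kept-child   : ∀ {v c} → Kept v → IsChild T c v → ∃ λ c' → Kept c' × c' ≢ top × up c' ≡ v
    leaf-kept    : ∀ a → Kept (leaf T (g a))
    kept-leaf    : ∀ x → Kept (leaf T x) → ∃ λ a → g a ≡ x
    lca-kept     : ∀ {a b w} → IsLca T (leaf T (g a)) (leaf T (g b)) w → Kept w
    kept-floor   : ∀ {a t} → leaf T (g a) ≼ t →
                   ∃ λ v → Kept v × leaf T (g a) ≼ v × v ≼ t × (∀ {w} → Kept w → w ≼ t → w ≼ v)

module PrunedTree {N n : ℕ} {T : PhyloTree N} {g : Fin n → Fin N}
                  (Pr : Pruning T g) (g-injective : ∀ a b → g a ≡ g b → a ≡ b) where
  open Pruning Pr
  open Enumeration enumeration
  open Ancestry T using (_≼_; ≼-refl; ≼-trans; ≼-isLeaf)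

  parent' : Fin size → Fin size
  parent' v = index (up-kept (element-kept v))

  element-parent' : ∀ v → element (parent' v) ≡ up (element v)
  element-parent' v = element-index (up-kept (element-kept v))

  root' : Fin size
  root' = index top-kept

  _≼'_ : Fin size → Fin size → Set
  v ≼' u = ∃ λ k → iter parent' k v ≡ u

  element-mono : ∀ {v u} → v ≼' u → element v ≼ element u
  element-mono (k , p) = go k p
    where
    go : ∀ k {v u} → iter parent' k v ≡ u → element v ≼ element u
    go zero refl = ≼-refl
    go (suc k) {v} p = ≼-trans (subst (element v ≼_) (sym (element-parent' v)) (≼-up (element-kept v)))
                               (go k (trans (sym (iter-suc parent' k v)) p))

  element-reflects : ∀ {v u} → element v ≼ element u → v ≼' u
  element-reflects (k , p) = go k ≤-refl p
    where
    go : ∀ {v u} fuel {k} → k ≤ fuel → iter (parent T) k (element v) ≡ element u → v ≼' u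
    go _ {zero} _ p = 0 , element-injective _ _ p
    go {v} {u} (suc fuel) {suc k} (s≤s k≤fuel) p
      with up-shortcut k (element-kept v) (element-kept u) p
    ... | j , j≤k , q with go fuel (≤-trans j≤k k≤fuel) (trans (cong (iter (parent T) j) (element-parent' v)) q)
    ...   | i , r = suc i , trans (iter-suc parent' i v) r

  reaches-root' : ∀ v → v ≼' root'
  reaches-root' v = element-reflects (subst (element v ≼_) (sym (element-index top-kept)) (≼-top (element-kept v)))

  leaf' : Fin n → Fin size
  leaf' a = index (leaf-kept a)

  IsChild' : Fin size → Fin size → Set
  IsChild' c u = c ≢ root' × parent' c ≡ u

  child'⇒child : ∀ {c u} → IsChild' c u → element c ≢ top × up (element c) ≡ element u
  child'⇒child {c} {u} (c≢root , pc≡u) =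
    (λ c≡top → c≢root (element-injective _ _ (trans c≡top (sym (element-index top-kept))))) ,
    trans (sym (element-parent' c)) (cong element pc≡u)

  child⇒child' : ∀ {w u} (kept : Kept w) → w ≢ top → up w ≡ element u → IsChild' (index kept) u
  child⇒child' {w} kept w≢top uw≡u =
    (λ i≡root → w≢top (trans (sym (element-index kept)) (trans (cong element i≡root) (element-index top-kept)))) ,
    element-injective _ _ (trans (element-parent' _) (trans (cong up (element-index kept)) uw≡u))

  phylogenetic' : ∀ u c → IsChild' c u → ∃ λ c' → IsChild' c' u × c' ≢ c
  phylogenetic' u c child' with child'⇒child child'
  ... | c≢top , uc≡u with up-branching (element-kept c) c≢top
  ...   | w , kept , w≢top , uw≡uc , w≢c =
    index kept , child⇒child' kept w≢top (trans uw≡uc uc≡u) ,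
    λ i≡c → w≢c (trans (sym (element-index kept)) (cong element i≡c))

  leaf'-isLeaf : ∀ a c → ¬ IsChild' c (leaf' a)
  leaf'-isLeaf a c child' with child'⇒child child'
  ... | _ , uc≡leaf = proj₁ child' (trans (sym (iter-fixed parent' fixed k)) p)
    where
    ℓ = element-index (leaf-kept a)
    c≡leaf : element c ≡ leaf T (g a)
    c≡leaf = ≼-isLeaf (leaf-isLeaf T (g a)) (subst (element c ≼_) (trans uc≡leaf ℓ) (≼-up (element-kept c)))
    fixed : parent' c ≡ c
    fixed = element-injective _ _ (trans (element-parent' c) (trans uc≡leaf (trans ℓ (sym c≡leaf))))
    k = proj₁ (reaches-root' c)
    p = proj₂ (reaches-root' c)

  leaf'-onto : ∀ v → (∀ c → ¬ IsChild' c v) → ∃ λ a → leaf' a ≡ v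
  leaf'-onto v childless with leaf-onto T (element v) isLeaf
    where
    isLeaf : IsLeaf T (element v)
    isLeaf c child with kept-child (element-kept v) child
    ... | c' , kept , c'≢top , uc'≡v = childless (index kept) (child⇒child' kept c'≢top uc'≡v)
  ... | x , leaf≡v with kept-leaf x (subst Kept (sym leaf≡v) (element-kept v))
  ...   | a , refl = a , element-injective _ _ (trans (element-index (leaf-kept a)) leaf≡v)

  T' : PhyloTree n
  T' = record
    { m              = size
    ; ρ              = root'
    ; parent         = parent'
    ; parentρ        = element-injective _ _
                         (trans (element-parent' root') (trans (cong up (element-index top-kept))
                                (trans up-top (sym (element-index top-kept)))))
    ; reachesRoot    = reaches-root'
    ; leaf           = leaf'
    ; phylogenetic   = phylogenetic'
    ; leaf-injective = λ a b eq → g-injective a b (leaf-injective T _ _ (begin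
                         leaf T (g a)        ≡⟨ sym (element-index (leaf-kept a)) ⟩
                         element (leaf' a)   ≡⟨ cong element eq ⟩
                         element (leaf' b)   ≡⟨ element-index (leaf-kept b) ⟩
                         leaf T (g b)        ∎))
    ; leaf-isLeaf    = leaf'-isLeaf
    ; leaf-onto      = leaf'-onto
    }
    where open ≡-Reasoning

  restriction : Restriction T T' g
  restriction = record
    { embed          = element
    ; embed-mono     = element-mono
    ; embed-reflects = element-reflects
    ; embed-leaf     = λ a → element-index (leaf-kept a)
    ; lca-image      = λ isLca → index (lca-kept isLca) , element-index (lca-kept isLca)
    ; floor          = λ a≼t → let (_ , kept , _) = kept-floor a≼t in index kept
    ; leaf-≼-floor   = λ a≼t → let (_ , kept , a≼v , _) = kept-floor a≼t in
                         element-reflects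
                           (subst₂ _≼_ (sym (element-index (leaf-kept _))) (sym (element-index kept)) a≼v)
    ; embed-floor-≼  = λ a≼t → let (_ , kept , _ , v≼t , _) = kept-floor a≼t in
                         subst (_≼ _) (sym (element-index kept)) v≼t
    ; floor-greatest = λ a≼t _ w≼t → let (_ , kept , _ , _ , greatest) = kept-floor a≼t in
                         element-reflects (subst (_ ≼_) (sym (element-index kept)) (greatest (element-kept _) w≼t))
    }

-- Deleting the leaf X: if its parent P has a third child only X goes; otherwise P is suppressed
-- too, and X's sibling C is reattached to the parent of P, or becomes the root.
module LeafDeletion {n : ℕ} (T : PhyloTree (suc (suc n))) (z : Fin (suc (suc n))) where
  open Ancestry T

  X : Fin (m T)
  X = leaf T z

  P : Fin (m T)
  P = parent T X

  ≼X⇒≡X : ∀ {w} → w ≼ X → w ≡ X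
  ≼X⇒≡X = ≼-isLeaf (leaf-isLeaf T z)

  leaf≢X : ∀ a → leaf T (punchIn z a) ≢ X
  leaf≢X a = Fin.punchInᵢ≢i z a ∘ leaf-injective T _ _

  X≢ρ : X ≢ ρ T
  X≢ρ X≡ρ = leaf≢X zero (trans (≼-isLeaf ρ-isLeaf (reachesRoot T _)) (sym X≡ρ))
    where
    ρ-isLeaf : IsLeaf T (ρ T)
    ρ-isLeaf = subst (IsLeaf T) X≡ρ (leaf-isLeaf T z)

  P≢X : P ≢ X
  P≢X = X≢ρ ∘ fixed⇒root

  X-child : IsChild T X P
  X-child = X≢ρ , refl

  C : Fin (m T)
  C = proj₁ (phylogenetic T P X X-child)

  C-child : IsChild T C P
  C-child = proj₁ (proj₂ (phylogenetic T P X X-child))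

  C≢X : C ≢ X
  C≢X = proj₂ (proj₂ (phylogenetic T P X X-child))

  parent≢X : ∀ {w} → w ≢ X → parent T w ≢ X
  parent≢X {w} w≢X pw≡X with w ≟ ρ T
  ... | yes refl = X≢ρ (trans (sym pw≡X) (parentρ T))
  ... | no w≢ρ = leaf-isLeaf T z w (w≢ρ , pw≡X)

  above-leaf≢X : ∀ {a t} → leaf T (punchIn z a) ≼ t → t ≢ X
  above-leaf≢X {a} a≼t t≡X = leaf≢X a (≼X⇒≡X (subst (_ ≼_) t≡X a≼t))

  leaf-image : ∀ x → leaf T x ≢ X → ∃ λ a → punchIn z a ≡ x
  leaf-image x x≢X = punchOut z≢x , Fin.punchIn-punchOut z≢x
    where
    z≢x : z ≢ x
    z≢x = x≢X ∘ cong (leaf T) ∘ sym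

  third-child-or-binary : (∃ λ D → IsChild T D P × D ≢ X × D ≢ C) ⊎
                          (∀ d → IsChild T d P → d ≡ X ⊎ d ≡ C)
  third-child-or-binary
    with Fin.any? (λ d → (¬? (d ≟ ρ T) ×-dec parent T d ≟ P) ×-dec ¬? (d ≟ X) ×-dec ¬? (d ≟ C))
  ... | yes third = inj₁ third
  ... | no noThird = inj₂ binary
    where
    binary : ∀ d → IsChild T d P → d ≡ X ⊎ d ≡ C
    binary d d-child with d ≟ X | d ≟ C
    ... | yes d≡X | _ = inj₁ d≡X
    ... | no _ | yes d≡C = inj₂ d≡C
    ... | no d≢X | no d≢C = ⊥-elim (noThird (d , d-child , d≢X , d≢C))

  module ThirdChild (D : Fin (m T)) (D-child : IsChild T D P) (D≢X : D ≢ X) (D≢C : D ≢ C) where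

    up-branching : ∀ {w} → w ≢ X → w ≢ ρ T →
                   ∃ λ w' → w' ≢ X × w' ≢ ρ T × parent T w' ≡ parent T w × w' ≢ w
    up-branching {w} w≢X w≢ρ with phylogenetic T (parent T w) w (w≢ρ , refl)
    ... | c , (c≢ρ , pc≡pw) , c≢w with c ≟ X
    ...   | no c≢X = c , c≢X , c≢ρ , pc≡pw , c≢w
    ...   | yes refl with w ≟ C
    ...     | yes refl = D , D≢X , proj₁ D-child , trans (proj₂ D-child) pc≡pw , D≢C
    ...     | no w≢C = C , C≢X , proj₁ C-child , trans (proj₂ C-child) pc≡pw , w≢C ∘ sym

    kept-child : ∀ {v c} → IsChild T c v → ∃ λ c' → c' ≢ X × c' ≢ ρ T × parent T c' ≡ v
    kept-child {v} {c} (c≢ρ , pc≡v) with c ≟ X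
    ... | no c≢X = c , c≢X , c≢ρ , pc≡v
    ... | yes refl = C , C≢X , proj₁ C-child , trans (proj₂ C-child) pc≡v

    pruning : Pruning T (punchIn z)
    pruning = record
      { Kept         = _≢ X
      ; enumeration  = enumerate-≢ X
      ; up           = parent T
      ; top          = ρ T
      ; up-kept      = parent≢X
      ; top-kept     = X≢ρ ∘ sym
      ; up-top       = parentρ T
      ; ≼-up         = λ _ → 1 , refl
      ; up-shortcut  = λ k {w} _ _ p → k , ≤-refl , trans (sym (iter-suc (parent T) k w)) p
      ; ≼-top        = λ {w} _ → reachesRoot T w
      ; up-branching = up-branching
      ; kept-child   = λ _ → kept-child
      ; leaf-kept    = leaf≢X
      ; kept-leaf    = leaf-image
      ; lca-kept     = above-leaf≢X ∘ proj₁
      ; kept-floor   = λ {_} {t} a≼t → t , above-leaf≢X a≼t , a≼t , ≼-refl , λ _ w≼t → w≼t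
      }

  module Binary (binary : ∀ d → IsChild T d P → d ≡ X ⊎ d ≡ C) where

    Kept : Fin (m T) → Set
    Kept w = w ≢ X × w ≢ P

    C-kept : Kept C
    C-kept = C≢X , λ C≡P → proj₁ C-child (fixed⇒root (trans (proj₂ C-child) (sym C≡P)))

    leaf-kept : ∀ a → Kept (leaf T (punchIn z a))
    leaf-kept a = leaf≢X a , λ leaf≡P → leaf-isLeaf T (punchIn z a) X (X≢ρ , sym leaf≡P)

    ≼P⇒≼C : ∀ {w} → Kept w → w ≼ P → w ≼ C
    ≼P⇒≼C (w≢X , w≢P) w≼P with ≼-child w≼P w≢P
    ... | c , c-child , w≼c with binary c c-child
    ...   | inj₁ refl = ⊥-elim (w≢X (≼X⇒≡X w≼c))
    ...   | inj₂ refl = w≼c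

    parent-kept : ∀ {w} → Kept w → w ≢ C → Kept (parent T w)
    parent-kept {w} (w≢X , w≢P) w≢C = parent≢X w≢X , pw≢P
      where
      pw≢P : parent T w ≢ P
      pw≢P pw≡P with w ≟ ρ T
      ... | yes w≡ρ = w≢P (root-parent w≡ρ pw≡P)
      ... | no w≢ρ with binary w (w≢ρ , pw≡P)
      ...   | inj₁ w≡X = w≢X w≡X
      ...   | inj₂ w≡C = w≢C w≡C

    child-of-kept : ∀ {v c} → Kept v → IsChild T c v → c ≡ P ⊎ (Kept c × c ≢ C)
    child-of-kept {v} {c} (_ , v≢P) (_ , pc≡v) with c ≟ P
    ... | yes c≡P = inj₁ c≡P
    ... | no c≢P = inj₂ (((λ c≡X → v≢P (trans (sym pc≡v) (cong (parent T) c≡X))) , c≢P) ,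
                          λ c≡C → v≢P (trans (sym pc≡v) (trans (cong (parent T) c≡C) (proj₂ C-child))))

    lca-kept : ∀ {a b w} → IsLca T (leaf T (punchIn z a)) (leaf T (punchIn z b)) w → Kept w
    lca-kept {a} {b} (a≼w , b≼w , least) = above-leaf≢X a≼w , w≢P
      where
      w≢P : _ ≢ P
      w≢P refl = proj₂ C-kept (≼-antisym (1 , proj₂ C-child)
                   (least C (≼P⇒≼C (leaf-kept a) a≼w) (≼P⇒≼C (leaf-kept b) b≼w)))

    kept-leaf : ∀ x → Kept (leaf T x) → ∃ λ a → punchIn z a ≡ x
    kept-leaf x = leaf-image x ∘ proj₁

    kept-floor : ∀ {a t} → leaf T (punchIn z a) ≼ t →
                 ∃ λ v → Kept v × leaf T (punchIn z a) ≼ v × v ≼ t × (∀ {w} → Kept w → w ≼ t → w ≼ v)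
    kept-floor {a} {t} a≼t with t ≟ P
    ... | yes refl = C , C-kept , ≼P⇒≼C (leaf-kept a) a≼t , (1 , proj₂ C-child) , ≼P⇒≼C
    ... | no t≢P = t , (above-leaf≢X a≼t , t≢P) , a≼t , ≼-refl , λ _ w≼t → w≼t

    reattach : Fin (m T) → Fin (m T) → Fin (m T)
    reattach new w with w ≟ C
    ... | yes _ = new
    ... | no _  = parent T w

    reattach-C : ∀ {new} → reattach new C ≡ new
    reattach-C with C ≟ C
    ... | yes _ = refl
    ... | no C≢C = ⊥-elim (C≢C refl)

    reattach-≢C : ∀ {new w} → w ≢ C → reattach new w ≡ parent T w
    reattach-≢C {w = w} w≢C with w ≟ C
    ... | yes w≡C = ⊥-elim (w≢C w≡C)
    ... | no _ = refl

    reattach-kept : ∀ {new w} → Kept new → Kept w → Kept (reattach new w)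
    reattach-kept {w = w} new-kept kept with w ≟ C
    ... | yes _ = new-kept
    ... | no w≢C = parent-kept kept w≢C

    module RootParent (P≡ρ : P ≡ ρ T) where

      up : Fin (m T) → Fin (m T)
      up = reattach C

      ≼-up : ∀ {w} → Kept w → w ≼ up w
      ≼-up {w} _ with w ≟ C
      ... | yes refl = ≼-refl
      ... | no _ = 1 , refl

      up-shortcut : ∀ k {w u} → Kept w → Kept u → iter (parent T) (suc k) w ≡ u →
                    ∃ λ j → j ≤ k × iter (parent T) j (up w) ≡ u
      up-shortcut k {w} {u} _ (_ , u≢P) p with w ≟ C
      ... | no _ = k , ≤-refl , trans (sym (iter-suc (parent T) k w)) p
      ... | yes refl = ⊥-elim (u≢P (begin
        u                              ≡⟨ sym p ⟩
        iter (parent T) (suc k) C      ≡⟨ iter-suc (parent T) k C ⟩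
        iter (parent T) k (parent T C) ≡⟨ cong (iter (parent T) k) (trans (proj₂ C-child) P≡ρ) ⟩
        iter (parent T) k (ρ T)        ≡⟨ iter-root k ⟩
        ρ T                            ≡⟨ sym P≡ρ ⟩
        P                              ∎))
        where open ≡-Reasoning

      ≼-top : ∀ {w} → Kept w → w ≼ C
      ≼-top {w} kept = ≼P⇒≼C kept (subst (w ≼_) (sym P≡ρ) (reachesRoot T w))

      up-branching : ∀ {w} → Kept w → w ≢ C → ∃ λ w' → Kept w' × w' ≢ C × up w' ≡ up w × w' ≢ w
      up-branching {w} kept w≢C
        with phylogenetic T (parent T w) w ((λ w≡ρ → proj₂ kept (trans w≡ρ (sym P≡ρ))) , refl)
      ... | c , c-child , c≢w with child-of-kept (parent-kept kept w≢C) c-child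
      ...   | inj₁ c≡P = ⊥-elim (proj₁ c-child (trans c≡P P≡ρ))
      ...   | inj₂ (c-kept , c≢C) =
        c , c-kept , c≢C , trans (reattach-≢C c≢C) (trans (proj₂ c-child) (sym (reattach-≢C w≢C))) , c≢w

      kept-child : ∀ {v c} → Kept v → IsChild T c v → ∃ λ c' → Kept c' × c' ≢ C × up c' ≡ v
      kept-child v-kept c-child with child-of-kept v-kept c-child
      ... | inj₁ c≡P = ⊥-elim (proj₁ c-child (trans c≡P P≡ρ))
      ... | inj₂ (c-kept , c≢C) = _ , c-kept , c≢C , trans (reattach-≢C c≢C) (proj₂ c-child)

      pruning : Pruning T (punchIn z)
      pruning = record
        { Kept = Kept ; enumeration = Enumeration-remove (enumerate-≢ X) P≢X
        ; up = up ; top = C ; up-kept = reattach-kept C-kept ; top-kept = C-kept ; up-top = reattach-C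
        ; ≼-up = ≼-up ; up-shortcut = up-shortcut ; ≼-top = ≼-top
        ; up-branching = up-branching ; kept-child = kept-child
        ; leaf-kept = leaf-kept ; kept-leaf = kept-leaf ; lca-kept = lca-kept ; kept-floor = kept-floor
        }

    module InnerParent (P≢ρ : P ≢ ρ T) where

      up : Fin (m T) → Fin (m T)
      up = reattach (parent T P)

      parentP-kept : Kept (parent T P)
      parentP-kept = parent≢X P≢X , P≢ρ ∘ fixed⇒root

      ≼-up : ∀ {w} → Kept w → w ≼ up w
      ≼-up {w} _ with w ≟ C
      ... | yes refl = 2 , cong (parent T) (proj₂ C-child)
      ... | no _ = 1 , refl

      up-shortcut : ∀ k {w u} → Kept w → Kept u → iter (parent T) (suc k) w ≡ u →
                    ∃ λ j → j ≤ k × iter (parent T) j (up w) ≡ u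
      up-shortcut k {w} _ _ p with w ≟ C
      up-shortcut k {w} _ _ p | no _ = k , ≤-refl , trans (sym (iter-suc (parent T) k w)) p
      up-shortcut zero _ (_ , u≢P) p | yes refl = ⊥-elim (u≢P (trans (sym p) (proj₂ C-child)))
      up-shortcut (suc k) {u = u} _ _ p | yes refl = k , n≤1+n k , (begin
        iter (parent T) k (parent T P)            ≡⟨ cong (iter (parent T) k ∘ parent T) (sym (proj₂ C-child)) ⟩
        iter (parent T) k (parent T (parent T C)) ≡⟨ sym (iter-suc (parent T) k (parent T C)) ⟩
        iter (parent T) (suc k) (parent T C)      ≡⟨ sym (iter-suc (parent T) (suc k) C) ⟩
        iter (parent T) (suc (suc k)) C           ≡⟨ p ⟩
        u                                         ∎)
        where open ≡-Reasoning

      up-branching : ∀ {w} → Kept w → w ≢ ρ T → ∃ λ w' → Kept w' × w' ≢ ρ T × up w' ≡ up w × w' ≢ w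
      up-branching {w} kept w≢ρ with w ≟ C
      ... | yes refl with phylogenetic T (parent T P) P (P≢ρ , refl)
      ...   | c , c-child , c≢P with child-of-kept parentP-kept c-child
      ...     | inj₁ c≡P = ⊥-elim (c≢P c≡P)
      ...     | inj₂ (c-kept , c≢C) =
        c , c-kept , proj₁ c-child , trans (reattach-≢C c≢C) (proj₂ c-child) , c≢C
      up-branching {w} kept w≢ρ | no w≢C with phylogenetic T (parent T w) w (w≢ρ , refl)
      ... | c , c-child , c≢w with child-of-kept (parent-kept kept w≢C) c-child
      ...   | inj₁ c≡P = C , C-kept , proj₁ C-child ,
                         trans reattach-C (trans (cong (parent T) (sym c≡P)) (proj₂ c-child)) , w≢C ∘ sym
      ...   | inj₂ (c-kept , c≢C) =
        c , c-kept , proj₁ c-child , trans (reattach-≢C c≢C) (proj₂ c-child) , c≢w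

      kept-child : ∀ {v c} → Kept v → IsChild T c v → ∃ λ c' → Kept c' × c' ≢ ρ T × up c' ≡ v
      kept-child v-kept c-child with child-of-kept v-kept c-child
      ... | inj₁ c≡P =
        C , C-kept , proj₁ C-child , trans reattach-C (trans (cong (parent T) (sym c≡P)) (proj₂ c-child))
      ... | inj₂ (c-kept , c≢C) = _ , c-kept , proj₁ c-child , trans (reattach-≢C c≢C) (proj₂ c-child)

      pruning : Pruning T (punchIn z)
      pruning = record
        { Kept = Kept ; enumeration = Enumeration-remove (enumerate-≢ X) P≢X
        ; up = up ; top = ρ T ; up-kept = reattach-kept parentP-kept ; top-kept = (X≢ρ ∘ sym) , (P≢ρ ∘ sym)
        ; up-top = trans (reattach-≢C (proj₁ C-child ∘ sym)) (parentρ T)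
        ; ≼-up = ≼-up ; up-shortcut = up-shortcut ; ≼-top = λ {w} _ → reachesRoot T w
        ; up-branching = up-branching ; kept-child = kept-child
        ; leaf-kept = leaf-kept ; kept-leaf = kept-leaf ; lca-kept = lca-kept ; kept-floor = kept-floor
        }

  pruning : Pruning T (punchIn z)
  pruning with third-child-or-binary | P ≟ ρ T
  ... | inj₁ (D , D-child , D≢X , D≢C) | _ = ThirdChild.pruning D D-child D≢X D≢C
  ... | inj₂ binary | yes P≡ρ = Binary.RootParent.pruning binary P≡ρ
  ... | inj₂ binary | no P≢ρ  = Binary.InnerParent.pruning binary P≢ρ

delete-leaf : ∀ {n} (T : PhyloTree (suc (suc n))) z → Σ (PhyloTree (suc n)) λ T' → Restriction T T' (punchIn z)
delete-leaf T z = PrunedTree.T' pruning injective , PrunedTree.restriction pruning injective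
  where
  pruning = LeafDeletion.pruning T z
  injective = Fin.punchIn-injective z

surjective-or-misses : ∀ {n N} (f : Fin n → Fin N) →
                       (∀ x → ∃ λ a → f a ≡ x) ⊎ ∃ λ z → ∀ a → f a ≢ z
surjective-or-misses f with Fin.all? (λ x → Fin.any? (λ a → f a ≟ x))
... | yes surjective = inj₁ surjective
... | no ¬surjective with Fin.¬∀⟶∃¬ _ _ (λ x → Fin.any? (λ a → f a ≟ x)) ¬surjective
...   | z , missed = inj₂ (z , λ a fa≡z → missed (a , fa≡z))

restriction : ∀ {N k} (T : PhyloTree N) (f : Fin (suc k) → Fin N) → (∀ a b → f a ≡ f b → a ≡ b) →
              Σ (PhyloTree (suc k)) λ T' → Restriction T T' f

restriction-missing : ∀ {N k} (T : PhyloTree N) (f : Fin (suc k) → Fin N) → (∀ a b → f a ≡ f b → a ≡ b) →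
                      ∀ z → (∀ a → f a ≢ z) → Σ (PhyloTree (suc k)) λ T' → Restriction T T' f
restriction-missing {1} T f _ zero missed with f zero in fa
... | zero = ⊥-elim (missed zero fa)
restriction-missing {suc (suc N)} T f f-injective z missed =
  let (T' , R') = delete-leaf T z ; (T'' , R'') = restriction T' f' f'-injective
  in T'' , Restriction-resp-≗ punchIn-f' (Restriction-∘ R' R'')
  where
  f' : Fin _ → Fin (suc N)
  f' a = punchOut (missed a ∘ sym)
  punchIn-f' : ∀ a → punchIn z (f' a) ≡ f a
  punchIn-f' a = Fin.punchIn-punchOut (missed a ∘ sym)
  f'-injective : ∀ a b → f' a ≡ f' b → a ≡ b
  f'-injective a b eq = f-injective a b (trans (sym (punchIn-f' a)) (trans (cong (punchIn z) eq) (punchIn-f' b)))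

restriction T f f-injective with surjective-or-misses f
... | inj₁ surjective = relabel T f f-injective surjective , relabel-restriction T f f-injective surjective
... | inj₂ (z , missed) = restriction-missing T f f-injective z missed

proposition3p1 : ∀ {n : ℕ} (G : Graph n) → IsUn2qBMG G →
                   ∀ {k : ℕ} (f : Fin (suc k) → Fin n) →
                   (∀ a b → f a ≡ f b → a ≡ b) →
                   IsUn2qBMG (induced G f)
proposition3p1 G (A , σ , (T , U , quasiBestMatches) , underlying) f f-injective =
  (λ a b → A (f a) (f b)) , σ ∘ f ,
  RestrictedQuasiBestMatches.restriction-2qBMG (proj₂ (restriction T f f-injective)) σ U A quasiBestMatches ,
  λ a b → underlying (f a) (f b)
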